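{- A Cayley permutation $\pi$ is hare pop-stack sortable if and only if $\pi$ avoids $231$, $312$ and $2121$.
   Context: A Cayley permutation is a finite word $\pi=\pi_1\cdots\pi_n$ over the positive integers such that every integer from $1$ to $\max(\pi)$ occurs at least once. A word contains a pattern $p=p_1\cdots p_k$ if it has a subsequence $x_{i_1}\cdots x_{i_k}$ with $x_{i_u}<x_{i_v}$ iff $p_u<p_v$ and $x_{i_u}=x_{i_v}$ iff $p_u=p_v$; otherwise it avoids $p$. A hare pop-stack processes an input from left to right with a right-greedy algorithm: while the input is nonempty, the next input element is pushed if the resulting stack contents, read from top to bottom, avoid the pattern $21$ (i.e. are weakly increasing from top to bottom); otherwise a pop operation is performed, which removes all elements of the stack, appending them to the output in order from top to bottom. When the input is exhausted, the stack is emptied in the same way. $\pi$ is hare pop-stack sortable if the output on input $\pi$ is weakly increasing. -}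

module Defs where

open import Data.Nat using (ℕ; _≤_; _<_; _≤?_; _⊔_)
open import Data.List using (List; []; _∷_; _++_; [_]; foldr; zip; length)
open import Data.List.Relation.Unary.All using (All)
open import Data.List.Relation.Unary.AllPairs using (AllPairs)
open import Data.List.Relation.Unary.Linked using (Linked)
open import Data.List.Relation.Binary.Sublist.Propositional using (_⊆_)
open import Data.List.Membership.Propositional using (_∈_)
open import Data.Product using (_×_; ∃)
open import Relation.Binary.PropositionalEquality using (_≡_)
open import Relation.Nullary using (¬_; yes; no)
open import Function.Bundles using (_⇔_)

Word : Set
Word = List ℕ

maxW : Word → ℕ
maxW = foldr _⊔_ 0

CayleyPerm : Word → Set
CayleyPerm π = All (1 ≤_) π × (∀ k → 1 ≤ k → k ≤ maxW π → k ∈ π)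

Compat : ℕ × ℕ → ℕ × ℕ → Set
Compat (a Data.Product., x) (b Data.Product., y) =
  ((a < b) ⇔ (x < y)) × ((b < a) ⇔ (y < x)) × ((a ≡ b) ⇔ (x ≡ y))

OrderIso : Word → Word → Set
OrderIso s p = length s ≡ length p × AllPairs Compat (zip s p)

Contains : Word → Word → Set
Contains w p = ∃ λ s → s ⊆ w × OrderIso s p

Avoids : Word → Word → Set
Avoids w p = ¬ Contains w p

-- Hare pop-stack: stack is a list with top first, input, producing output.
hareRun : List ℕ → List ℕ → List ℕ
hareRun st [] = st
hareRun [] (x ∷ xs) = hareRun [ x ] xs
hareRun (t ∷ st) (x ∷ xs) with x ≤? t
... | yes _ = hareRun (x ∷ t ∷ st) xs
... | no _ = (t ∷ st) ++ hareRun [ x ] xs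

hare : Word → Word
hare = hareRun []

HareSortable : Word → Set
HareSortable π = Linked _≤_ (hare π)

-- The hare pop-stack pushes while the input weakly decreases and pops at every strict ascent,
-- so its output is the input with each maximal weakly decreasing run reversed. That output is
-- weakly increasing exactly when no ascent a < b of the input has an entry weakly before a
-- that is larger than an entry weakly after b. Comparing those two entries with a and b shows
-- that such a configuration always contains 231, 312 or 2121, and each of these patterns
-- yields one: between the smaller and a later larger entry of the pattern there is an ascent.
module Submission where

open import Defs
open import Data.Nat using (ℕ; _≤_; _<_; _≤?_; _<?_; s≤s; z≤n)
open import Data.Nat.Properties using (≤-trans; <-trans; <-asym; <-irrefl; <⇒≱; ≮⇒≥; ≰⇒>; ≤-<-trans; <-cmp)
open import Data.List using ([]; _∷_; _++_; [_]; _ʳ++_)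
open import Data.List.Properties using (++-assoc; ++-identityʳ; ++-ʳ++)
open import Data.List.Relation.Unary.Any using (here; there)
open import Data.List.Relation.Unary.All as All using ([]; _∷_)
open import Data.List.Relation.Unary.All.Properties using (++⁻ʳ)
open import Data.List.Relation.Unary.AllPairs using (AllPairs; []; _∷_)
import Data.List.Relation.Unary.AllPairs.Properties as AllPairs
open import Data.List.Relation.Unary.Linked using (Linked; []; [-]; _∷_)
open import Data.List.Relation.Unary.Linked.Properties using (Linked⇒AllPairs; AllPairs⇒Linked)
open import Data.List.Relation.Binary.Sublist.Propositional using (_⊆_; _∷_; _∷ʳ_; minimum; from∈; lookup)
open import Data.List.Relation.Binary.Permutation.Propositional using (_↭_; ↭-refl; ↭-sym; ↭-trans; ↭-reflexive; prep)
open import Data.List.Relation.Binary.Permutation.Propositional.Properties using (∈-resp-↭; shift; ++⁺ˡ)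
open import Data.List.Membership.Propositional using (_∈_)
open import Data.List.Membership.Propositional.Properties using (∈-++⁺ˡ)
open import Data.Product using (_×_; _,_; ∃₂)
open import Data.Sum using (_⊎_; inj₁; inj₂; [_,_]′)
open import Function using (_∘_; id)
open import Function.Bundles using (_⇔_; mk⇔; Equivalence)
open import Relation.Binary.Core using (Rel)
open import Relation.Binary.Definitions using (Transitive; tri<; tri≈; tri>)
open import Relation.Binary.PropositionalEquality using (_≡_; refl; sym; trans; cong; subst)
open import Relation.Nullary using (¬_; yes; no; contradiction)

module _ {a ℓ} {A : Set a} {R : Rel A ℓ} where

  AllPairs-++⇒cross : ∀ xs {ys u v} → AllPairs R (xs ++ ys) → u ∈ xs → v ∈ ys → R u v
  AllPairs-++⇒cross (x ∷ xs) (Rx ∷ _)  (here refl) v∈ = All.lookup (++⁻ʳ xs Rx) v∈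
  AllPairs-++⇒cross (x ∷ xs) (_ ∷ Rxs) (there u∈)  v∈ = AllPairs-++⇒cross xs Rxs u∈ v∈

  module _ (R-trans : Transitive R) where

    Linked-++⇒cross : ∀ xs {ys u v} → Linked R (xs ++ ys) → u ∈ xs → v ∈ ys → R u v
    Linked-++⇒cross xs = AllPairs-++⇒cross xs ∘ Linked⇒AllPairs R-trans

    Linked-++⁺ : ∀ {xs ys} → Linked R xs → Linked R ys →
                 (∀ {u v} → u ∈ xs → v ∈ ys → R u v) → Linked R (xs ++ ys)
    Linked-++⁺ Rxs Rys cross = AllPairs⇒Linked (AllPairs.++⁺
      (Linked⇒AllPairs R-trans Rxs) (Linked⇒AllPairs R-trans Rys)
      (All.tabulate λ u∈ → All.tabulate λ v∈ → cross u∈ v∈))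

Sorted : Word → Set
Sorted = Linked _≤_

hareRun-↭ : ∀ st xs → hareRun st xs ↭ st ++ xs
hareRun-↭ st [] = ↭-reflexive (sym (++-identityʳ st))
hareRun-↭ [] (x ∷ xs) = hareRun-↭ [ x ] xs
hareRun-↭ (t ∷ st) (x ∷ xs) with x ≤? t
... | yes _ = ↭-trans (hareRun-↭ (x ∷ t ∷ st) xs) (↭-sym (shift x (t ∷ st) xs))
... | no _  = ++⁺ˡ (t ∷ st) (hareRun-↭ [ x ] xs)

hareRun-pop : ∀ {a b} st q → a < b → hareRun (a ∷ st) (b ∷ q) ≡ (a ∷ st) ++ hareRun [ b ] q
hareRun-pop {a} {b} st q a<b with b ≤? a
... | yes b≤a = contradiction b≤a (<⇒≱ a<b)
... | no _    = refl

hareRun-read : ∀ st x r → ∃₂ λ O S → hareRun st (x ∷ r) ≡ O ++ hareRun (x ∷ S) r × O ++ S ≡ st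
hareRun-read []       x r = [] , [] , refl , refl
hareRun-read (t ∷ st) x r with x ≤? t
... | yes _ = [] , t ∷ st , refl , refl
... | no _  = t ∷ st , [] , refl , ++-identityʳ (t ∷ st)

hare-readUpTo : ∀ p x r → ∃₂ λ O S → hare (p ʳ++ x ∷ r) ≡ O ++ hareRun (x ∷ S) r × O ++ S ↭ p
hare-readUpTo []      x r = [] , [] , refl , ↭-refl
hare-readUpTo (c ∷ p) x r with hare-readUpTo p c (x ∷ r)
... | O , S , run , O++S↭p with hareRun-read (c ∷ S) x r
...   | O′ , S′ , step , O′++S′≡c∷S =
  O ++ O′ , S′ ,
  trans run (trans (cong (O ++_) step) (sym (++-assoc O O′ _))) ,
  ↭-trans (↭-reflexive (trans (++-assoc O O′ S′) (cong (O ++_) O′++S′≡c∷S)))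
          (↭-trans (shift c O S) (prep c O++S↭p))

-- The prefix before the ascent is stored reversed (w ≡ before ʳ++ a ∷ b ∷ after), as on the
-- pop-stack; so x ∈ a ∷ before says that x occurs weakly before a.
record AscentInversion (w : Word) : Set where
  constructor ascentInversion
  field
    before     : Word
    a b        : ℕ
    after      : Word
    x y        : ℕ
    w-split    : w ≡ before ʳ++ a ∷ b ∷ after
    ascent     : a < b
    x-before-a : x ∈ a ∷ before
    y-after-b  : y ∈ b ∷ after
    inversion  : y < x

ascentInversion-ʳ++ : ∀ xs {ys} → AscentInversion ys → AscentInversion (xs ʳ++ ys)
ascentInversion-ʳ++ xs (ascentInversion before a b after x y refl a<b x∈ y∈ y<x) =
  ascentInversion (before ++ xs) a b after x y (sym (++-ʳ++ before)) a<b (∈-++⁺ˡ x∈) y∈ y<x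

sortable⇒¬ascentInversion : ∀ w → HareSortable w → ¬ AscentInversion w
sortable⇒¬ascentInversion w sorted (ascentInversion before a b after x y refl a<b x∈ y∈ y<x)
  with hare-readUpTo before a (b ∷ after)
... | O , S , run , O++S↭before = <⇒≱ y<x x≤y
  where
  output : hare w ≡ (O ++ a ∷ S) ++ hareRun [ b ] after
  output = trans run (trans (cong (O ++_) (hareRun-pop S after a<b)) (sym (++-assoc O (a ∷ S) _)))

  x≤y : x ≤ y
  x≤y = Linked-++⇒cross ≤-trans (O ++ a ∷ S) (subst Sorted output sorted)
    (∈-resp-↭ (↭-trans (prep a (↭-sym O++S↭before)) (↭-sym (shift a O S))) x∈)
    (∈-resp-↭ (↭-sym (hareRun-↭ [ b ] after)) y∈)

¬ascentInversion⇒sortedRun : ∀ t st xs → Sorted (t ∷ st) → ¬ AscentInversion ((t ∷ st) ʳ++ xs) →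
                              Sorted (hareRun (t ∷ st) xs)
¬ascentInversion⇒sortedRun t st []       sorted _ = sorted
¬ascentInversion⇒sortedRun t st (x ∷ xs) sorted ¬inv with x ≤? t
... | yes x≤t = ¬ascentInversion⇒sortedRun x (t ∷ st) xs (x≤t ∷ sorted) ¬inv
... | no x≰t  = Linked-++⁺ ≤-trans sorted
                  (¬ascentInversion⇒sortedRun x [] xs [-] (¬inv ∘ ascentInversion-ʳ++ (t ∷ st)))
                  cross
  where
  cross : ∀ {u v} → u ∈ t ∷ st → v ∈ hareRun [ x ] xs → u ≤ v
  cross {u} {v} u∈ v∈ = ≮⇒≥ λ v<u → ¬inv
    (ascentInversion st t x xs u v refl (≰⇒> x≰t) u∈ (∈-resp-↭ (hareRun-↭ [ x ] xs) v∈) v<u)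

¬ascentInversion⇒sortable : ∀ w → ¬ AscentInversion w → HareSortable w
¬ascentInversion⇒sortable []       _    = []
¬ascentInversion⇒sortable (x ∷ xs) ¬inv = ¬ascentInversion⇒sortedRun x [] xs [-] ¬inv

compat-< : ∀ {a b x y} → a < b → x < y → Compat (a , x) (b , y)
compat-< a<b x<y =
  mk⇔ (λ _ → x<y) (λ _ → a<b) ,
  mk⇔ (λ b<a → contradiction b<a (<-asym a<b)) (λ y<x → contradiction y<x (<-asym x<y)) ,
  mk⇔ (λ { refl → contradiction a<b (<-irrefl refl) }) (λ { refl → contradiction x<y (<-irrefl refl) })

compat-> : ∀ {a b x y} → b < a → y < x → Compat (a , x) (b , y)
compat-> b<a y<x with compat-< b<a y<x
... | a<b⇔ , b<a⇔ , a≡b⇔ = b<a⇔ , a<b⇔ , mk⇔ (sym ∘ Equivalence.to a≡b⇔ ∘ sym) (sym ∘ Equivalence.from a≡b⇔ ∘ sym)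

compat-≡ : ∀ {a x} → Compat (a , x) (a , x)
compat-≡ = both-irreflexive , both-irreflexive , mk⇔ (λ _ → refl) (λ _ → refl)
  where
  both-irreflexive : ∀ {a x} → a < a ⇔ x < x
  both-irreflexive = mk⇔ (λ a<a → contradiction a<a (<-irrefl refl)) (λ x<x → contradiction x<x (<-irrefl refl))

compat⇒< : ∀ {a b x y} → Compat (a , x) (b , y) → x < y → a < b
compat⇒< (a<b⇔x<y , _) = Equivalence.from a<b⇔x<y

compat⇒> : ∀ {a b x y} → Compat (a , x) (b , y) → y < x → b < a
compat⇒> (_ , b<a⇔y<x , _) = Equivalence.from b<a⇔y<x

1<2 : 1 < 2
1<2 = s≤s (s≤s z≤n)

1<3 : 1 < 3
1<3 = s≤s (s≤s z≤n)

2<3 : 2 < 3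
2<3 = s≤s 1<2

contains-231 : ∀ {w u v z} → (u ∷ v ∷ z ∷ []) ⊆ w → z < u → u < v → Contains w (2 ∷ 3 ∷ 1 ∷ [])
contains-231 s z<u u<v = _ , s , refl ,
  (compat-< u<v 2<3 ∷ compat-> z<u 1<2 ∷ []) ∷ (compat-> (<-trans z<u u<v) 1<3 ∷ []) ∷ [] ∷ []

contains-312 : ∀ {w x u v} → (x ∷ u ∷ v ∷ []) ⊆ w → u < v → v < x → Contains w (3 ∷ 1 ∷ 2 ∷ [])
contains-312 s u<v v<x = _ , s , refl ,
  (compat-> (<-trans u<v v<x) 1<3 ∷ compat-> v<x 2<3 ∷ []) ∷ (compat-< u<v 1<2 ∷ []) ∷ [] ∷ []

contains-2121 : ∀ {w x u} → (x ∷ u ∷ x ∷ u ∷ []) ⊆ w → u < x → Contains w (2 ∷ 1 ∷ 2 ∷ 1 ∷ [])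
contains-2121 s u<x = _ , s , refl ,
  (compat-> u<x 1<2 ∷ compat-≡ ∷ compat-> u<x 1<2 ∷ []) ∷
  (compat-< u<x 1<2 ∷ compat-≡ ∷ []) ∷
  (compat-> u<x 1<2 ∷ []) ∷ [] ∷ []

⊆-ʳ++ : ∀ xs {ys zs : Word} → ys ⊆ zs → ys ⊆ xs ʳ++ zs
⊆-ʳ++ []       ys⊆zs = ys⊆zs
⊆-ʳ++ (c ∷ xs) ys⊆zs = ⊆-ʳ++ xs (c ∷ʳ ys⊆zs)

∈-ʳ++-⊆ : ∀ {x} xs {ys zs : Word} → x ∈ xs → ys ⊆ zs → (x ∷ ys) ⊆ xs ʳ++ zs
∈-ʳ++-⊆ (c ∷ xs) (here refl) ys⊆zs = ⊆-ʳ++ xs (refl ∷ ys⊆zs)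
∈-ʳ++-⊆ (c ∷ xs) (there x∈) ys⊆zs = ∈-ʳ++-⊆ xs x∈ (c ∷ʳ ys⊆zs)

ascentInversion⇒contains : ∀ {w} → AscentInversion w →
  Contains w (2 ∷ 3 ∷ 1 ∷ []) ⊎ Contains w (3 ∷ 1 ∷ 2 ∷ []) ⊎ Contains w (2 ∷ 1 ∷ 2 ∷ 1 ∷ [])
ascentInversion⇒contains (ascentInversion before a b after x y refl a<b x∈ y∈ y<x)
  with x∈ | y∈
... | here refl | here refl = contradiction a<b (<-asym y<x)
... | here refl | there y∈after =
  inj₁ (contains-231 (⊆-ʳ++ before (refl ∷ refl ∷ from∈ y∈after)) y<x a<b)
... | there x∈before | here refl =
  inj₂ (inj₁ (contains-312 (∈-ʳ++-⊆ before x∈before (refl ∷ refl ∷ minimum after)) a<b y<x))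
... | there x∈before | there y∈after with <-cmp a y
...   | tri< a<y _ _ =
  inj₂ (inj₁ (contains-312 (∈-ʳ++-⊆ before x∈before (refl ∷ b ∷ʳ from∈ y∈after)) a<y y<x))
...   | tri> _ _ y<a = inj₁ (contains-231 (⊆-ʳ++ before (refl ∷ refl ∷ from∈ y∈after)) y<a a<b)
...   | tri≈ _ refl _ with <-cmp x b
...     | tri< x<b _ _ =
  inj₁ (contains-231 (∈-ʳ++-⊆ before x∈before (a ∷ʳ refl ∷ from∈ y∈after)) y<x x<b)
...     | tri> _ _ b<x =
  inj₂ (inj₁ (contains-312 (∈-ʳ++-⊆ before x∈before (refl ∷ refl ∷ minimum after)) a<b b<x))
...     | tri≈ _ refl _ =
  inj₂ (inj₂ (contains-2121 (∈-ʳ++-⊆ before x∈before (refl ∷ refl ∷ from∈ y∈after)) y<x))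

-- Walking right from u, the first ascent comes no later than the first entry exceeding u.
ascentInversion-between : ∀ w₁ u L {v r x y} → (v ∷ r) ⊆ L → u < v → x ∈ u ∷ w₁ → y ∈ v ∷ r → y < x →
                          AscentInversion (w₁ ʳ++ u ∷ L)
ascentInversion-between w₁ u (c ∷ L) s u<v x∈ y∈ y<x with u <? c
... | yes u<c = ascentInversion w₁ u c L _ _ refl u<c x∈ (lookup s y∈) y<x
... | no u≮c with s
...   | refl ∷ _ = contradiction u<v u≮c
...   | _ ∷ʳ s′  = ascentInversion-between (u ∷ w₁) c L s′ (≤-<-trans (≮⇒≥ u≮c) u<v) (there x∈) y∈ y<x

⊆-split : ∀ (acc : Word) {w u r} → (u ∷ r) ⊆ w →
          ∃₂ λ w₁ L → acc ʳ++ w ≡ w₁ ʳ++ u ∷ L × r ⊆ L × (∀ {z} → z ∈ acc → z ∈ w₁)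
⊆-split acc (y ∷ʳ s) with ⊆-split (y ∷ acc) s
... | w₁ , L , split , r⊆L , acc⊆w₁ = w₁ , L , split , r⊆L , acc⊆w₁ ∘ there
⊆-split acc (refl ∷ s) = acc , _ , refl , s , id

ascentInversion-⊆ : ∀ (acc : Word) {w u v r x y} → (u ∷ v ∷ r) ⊆ w → u < v → x ∈ u ∷ acc →
                    y ∈ v ∷ r → y < x → AscentInversion (acc ʳ++ w)
ascentInversion-⊆ acc s u<v x∈ y∈ y<x with ⊆-split acc s
... | w₁ , L , split , s′ , acc⊆w₁ =
  subst AscentInversion (sym split) (ascentInversion-between w₁ _ L s′ u<v (extend x∈) y∈ y<x)
  where
  extend : ∀ {z u} → z ∈ u ∷ acc → z ∈ u ∷ w₁
  extend (here z≡u) = here z≡u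
  extend (there z∈) = there (acc⊆w₁ z∈)

contains231⇒ascentInversion : ∀ {w} → Contains w (2 ∷ 3 ∷ 1 ∷ []) → AscentInversion w
contains231⇒ascentInversion ((_ ∷ _ ∷ _ ∷ []) , s , refl , (c₁₂ ∷ c₁₃ ∷ []) ∷ _) =
  ascentInversion-⊆ [] s (compat⇒< c₁₂ 2<3) (here refl) (there (here refl)) (compat⇒> c₁₃ 1<2)

contains312⇒ascentInversion : ∀ {w} → Contains w (3 ∷ 1 ∷ 2 ∷ []) → AscentInversion w
contains312⇒ascentInversion ((x ∷ _ ∷ _ ∷ []) , s , refl , (_ ∷ c₁₃ ∷ []) ∷ (c₂₃ ∷ []) ∷ _)
  with ⊆-split [] s
... | w₁ , L , refl , s′ , _ =
  ascentInversion-⊆ (x ∷ w₁) s′ (compat⇒< c₂₃ 1<2) (there (here refl)) (here refl) (compat⇒> c₁₃ 2<3)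

contains2121⇒ascentInversion : ∀ {w} → Contains w (2 ∷ 1 ∷ 2 ∷ 1 ∷ []) → AscentInversion w
contains2121⇒ascentInversion
  ((x ∷ _ ∷ _ ∷ _ ∷ []) , s , refl , (_ ∷ _ ∷ c₁₄ ∷ []) ∷ (c₂₃ ∷ _) ∷ _) with ⊆-split [] s
... | w₁ , L , refl , s′ , _ =
  ascentInversion-⊆ (x ∷ w₁) s′ (compat⇒< c₂₃ 1<2) (there (here refl)) (there (here refl)) (compat⇒> c₁₄ 1<2)

theorem9 : (π : Word) → CayleyPerm π →
    (HareSortable π ⇔ (Avoids π (2 ∷ 3 ∷ 1 ∷ []) × Avoids π (3 ∷ 1 ∷ 2 ∷ []) × Avoids π (2 ∷ 1 ∷ 2 ∷ 1 ∷ [])))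
theorem9 π _ = mk⇔
  (λ sortable → let ¬inv = sortable⇒¬ascentInversion π sortable in
    ¬inv ∘ contains231⇒ascentInversion ,
    ¬inv ∘ contains312⇒ascentInversion ,
    ¬inv ∘ contains2121⇒ascentInversion)
  (λ (avoids231 , avoids312 , avoids2121) → ¬ascentInversion⇒sortable π
    ([ avoids231 , [ avoids312 , avoids2121 ]′ ]′ ∘ ascentInversion⇒contains))
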